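{- For every reflexive globular set $G$, the reflexive globular set $T_0(G)$ is constant, i.e. isomorphic to $\Delta(A)$ for some set $A$ (all its cells of positive dimension are degenerate).
   Context: $\mathbb{T}_0$ is extensional Martin-Löf type theory: intensional type theory with dependent products, dependent sums, identity types (reflexivity $\mathrm{r}$, eliminator $J$), natural numbers, plus the reflection rule (from $p:\mathrm{Id}_A(a,b)$ infer $a=b$ definitionally); terms are modulo definitional equality. For a reflexive globular set $G$ (sets $G_n$, $s,t:G_{n+1}\to G_n$, $i:G_n\to G_{n+1}$ with $ss=st$, $ts=tt$, $si=ti=\mathrm{id}$), $\mathbb{T}_0[G]$ adds a basic type $\ulcorner G\urcorner$, a basic closed term for each cell of $G$ in the appropriate iterated identity type on $\ulcorner G\urcorner$, and conversions $\ulcorner i(\alpha)\urcorner=\mathrm{r}(\ulcorner\alpha\urcorner)$. $T_0(G)$ has $0$-cells the closed terms of type $\ulcorner G\urcorner$ and $(n{+}1)$-cells tuples $(\vec\alpha;\beta_0,\beta_1;\gamma)$ where $(\vec\alpha;\beta_0),(\vec\alpha;\beta_1)$ are $n$-cells and $\gamma$ is a closed term of the identity type between $\beta_0,\beta_1$; identities are given by reflexivity terms. $\Delta(A)$ denotes the reflexive globular set with every level equal to $A$ and all structure maps identities. -}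

module Defs where

open import Level using (0ℓ)
open import Data.Nat using (ℕ; zero; suc)
open import Data.Fin using (Fin; zero; suc)
open import Data.Unit using (⊤; tt)
open import Data.Product using (Σ; _×_; _,_; proj₁; proj₂)
open import Function using (_∘_; id)
open import Relation.Binary.PropositionalEquality using (_≡_)
open import Relation.Binary using (Setoid; IsEquivalence)

record RGlob : Set₁ where
  field
    Cell : ℕ → Set
    s t  : ∀ {n} → Cell (suc n) → Cell n
    i    : ∀ {n} → Cell n → Cell (suc n)
    ss≡st : ∀ {n} (x : Cell (suc (suc n))) → s (s x) ≡ s (t x)
    ts≡tt : ∀ {n} (x : Cell (suc (suc n))) → t (s x) ≡ t (t x)
    si≡id : ∀ {n} (x : Cell n) → s (i x) ≡ x
    ti≡id : ∀ {n} (x : Cell n) → t (i x) ≡ x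

-- Reflexive globular sets whose levels are setoids
-- (needed because cells of T₀(G) are terms modulo definitional equality)

record SRGS : Set₁ where
  field
    Cell  : ℕ → Set
    _≈_   : ∀ {n} → Cell n → Cell n → Set
    isEq  : ∀ {n} → IsEquivalence (_≈_ {n})
    src tgt : ∀ {n} → Cell (suc n) → Cell n
    idc   : ∀ {n} → Cell n → Cell (suc n)
    src-cong : ∀ {n} {x y : Cell (suc n)} → x ≈ y → src x ≈ src y
    tgt-cong : ∀ {n} {x y : Cell (suc n)} → x ≈ y → tgt x ≈ tgt y
    idc-cong : ∀ {n} {x y : Cell n} → x ≈ y → idc x ≈ idc y
    ss≈st : ∀ {n} (x : Cell (suc (suc n))) → src (src x) ≈ src (tgt x)
    ts≈tt : ∀ {n} (x : Cell (suc (suc n))) → tgt (src x) ≈ tgt (tgt x)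
    si≈id : ∀ {n} (x : Cell n) → src (idc x) ≈ x
    ti≈id : ∀ {n} (x : Cell n) → tgt (idc x) ≈ x

record Hom (X Y : SRGS) : Set where
  private
    module X = SRGS X
    module Y = SRGS Y
  field
    map      : ∀ {n} → X.Cell n → Y.Cell n
    map-cong : ∀ {n} {x y : X.Cell n} → X._≈_ x y → Y._≈_ (map x) (map y)
    map-src  : ∀ {n} (x : X.Cell (suc n)) → Y._≈_ (map (X.src x)) (Y.src (map x))
    map-tgt  : ∀ {n} (x : X.Cell (suc n)) → Y._≈_ (map (X.tgt x)) (Y.tgt (map x))
    map-idc  : ∀ {n} (x : X.Cell n) → Y._≈_ (map (X.idc x)) (Y.idc (map x))

record Iso (X Y : SRGS) : Set where
  private
    module X = SRGS X
    module Y = SRGS Y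
  field
    to   : Hom X Y
    from : Hom Y X
    from-to : ∀ {n} (x : X.Cell n) → X._≈_ (Hom.map from (Hom.map to x)) x
    to-from : ∀ {n} (y : Y.Cell n) → Y._≈_ (Hom.map to (Hom.map from y)) y

Δ : Setoid 0ℓ 0ℓ → SRGS
Δ A = record
  { Cell = λ _ → Carrier
  ; _≈_ = _≈_
  ; isEq = isEquivalence
  ; src = id ; tgt = id ; idc = id
  ; src-cong = id ; tgt-cong = id ; idc-cong = id
  ; ss≈st = λ _ → refl ; ts≈tt = λ _ → refl
  ; si≈id = λ _ → refl ; ti≈id = λ _ → refl }
  where open Setoid A

IsConstant : SRGS → Set₁
IsConstant X = Σ (Setoid 0ℓ 0ℓ) λ A → Iso X (Δ A)

-- The type theory 𝕋₀[G]: extensional Martin-Löf type theory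
-- (Π, Σ, Id, ℕ, reflection rule) extended by a basic type ⌜G⌝,
-- a basic closed term for each cell of G, and the conversions
-- ⌜i α⌝ = r(⌜α⌝).

module TT (G : RGlob) where
  module G = RGlob G

  mutual
    data Ty (n : ℕ) : Set where
      ΠT ΣT : Ty n → Ty (suc n) → Ty n
      IdT   : Ty n → Tm n → Tm n → Ty n
      NatT  : Ty n
      BaseT : Ty n

    data Tm (n : ℕ) : Set where
      var    : Fin n → Tm n
      cst    : (k : ℕ) → G.Cell k → Tm n
      lam    : Ty n → Ty (suc n) → Tm (suc n) → Tm n
      app    : Ty n → Ty (suc n) → Tm n → Tm n → Tm n
      pair   : Ty n → Ty (suc n) → Tm n → Tm n → Tm n
      split  : Ty n → Ty (suc n) → Ty (suc n) → Tm (suc (suc n)) → Tm n → Tm n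
      rfl    : Ty n → Tm n → Tm n
      J      : Ty n → Ty (suc (suc (suc n))) → Tm (suc n) → Tm n → Tm n → Tm n → Tm n
      ze     : Tm n
      su     : Tm n → Tm n
      natrec : Ty (suc n) → Tm n → Tm (suc (suc n)) → Tm n → Tm n

  Ren : ℕ → ℕ → Set
  Ren n m = Fin n → Fin m

  liftR : ∀ {n m} → Ren n m → Ren (suc n) (suc m)
  liftR ρ zero    = zero
  liftR ρ (suc x) = suc (ρ x)

  mutual
    renTy : ∀ {n m} → Ren n m → Ty n → Ty m
    renTy ρ (ΠT A B)    = ΠT (renTy ρ A) (renTy (liftR ρ) B)
    renTy ρ (ΣT A B)    = ΣT (renTy ρ A) (renTy (liftR ρ) B)
    renTy ρ (IdT A a b) = IdT (renTy ρ A) (renTm ρ a) (renTm ρ b)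
    renTy ρ NatT        = NatT
    renTy ρ BaseT       = BaseT

    renTm : ∀ {n m} → Ren n m → Tm n → Tm m
    renTm ρ (var x)          = var (ρ x)
    renTm ρ (cst k α)        = cst k α
    renTm ρ (lam A B t)      = lam (renTy ρ A) (renTy (liftR ρ) B) (renTm (liftR ρ) t)
    renTm ρ (app A B t u)    = app (renTy ρ A) (renTy (liftR ρ) B) (renTm ρ t) (renTm ρ u)
    renTm ρ (pair A B a b)   = pair (renTy ρ A) (renTy (liftR ρ) B) (renTm ρ a) (renTm ρ b)
    renTm ρ (split A B C d p) =
      split (renTy ρ A) (renTy (liftR ρ) B) (renTy (liftR ρ) C)
            (renTm (liftR (liftR ρ)) d) (renTm ρ p)
    renTm ρ (rfl A a)        = rfl (renTy ρ A) (renTm ρ a)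
    renTm ρ (J A C d a b p)  =
      J (renTy ρ A) (renTy (liftR (liftR (liftR ρ))) C) (renTm (liftR ρ) d)
        (renTm ρ a) (renTm ρ b) (renTm ρ p)
    renTm ρ ze               = ze
    renTm ρ (su k)           = su (renTm ρ k)
    renTm ρ (natrec C z s k) =
      natrec (renTy (liftR ρ) C) (renTm ρ z) (renTm (liftR (liftR ρ)) s) (renTm ρ k)

  wkTy : ∀ {n} → Ty n → Ty (suc n)
  wkTy = renTy suc

  wkTm : ∀ {n} → Tm n → Tm (suc n)
  wkTm = renTm suc

  Sub : ℕ → ℕ → Set
  Sub n m = Fin n → Tm m

  liftS : ∀ {n m} → Sub n m → Sub (suc n) (suc m)
  liftS σ zero    = var zero
  liftS σ (suc x) = wkTm (σ x)

  mutual
    subTy : ∀ {n m} → Sub n m → Ty n → Ty m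
    subTy σ (ΠT A B)    = ΠT (subTy σ A) (subTy (liftS σ) B)
    subTy σ (ΣT A B)    = ΣT (subTy σ A) (subTy (liftS σ) B)
    subTy σ (IdT A a b) = IdT (subTy σ A) (subTm σ a) (subTm σ b)
    subTy σ NatT        = NatT
    subTy σ BaseT       = BaseT

    subTm : ∀ {n m} → Sub n m → Tm n → Tm m
    subTm σ (var x)          = σ x
    subTm σ (cst k α)        = cst k α
    subTm σ (lam A B t)      = lam (subTy σ A) (subTy (liftS σ) B) (subTm (liftS σ) t)
    subTm σ (app A B t u)    = app (subTy σ A) (subTy (liftS σ) B) (subTm σ t) (subTm σ u)
    subTm σ (pair A B a b)   = pair (subTy σ A) (subTy (liftS σ) B) (subTm σ a) (subTm σ b)
    subTm σ (split A B C d p) =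
      split (subTy σ A) (subTy (liftS σ) B) (subTy (liftS σ) C)
            (subTm (liftS (liftS σ)) d) (subTm σ p)
    subTm σ (rfl A a)        = rfl (subTy σ A) (subTm σ a)
    subTm σ (J A C d a b p)  =
      J (subTy σ A) (subTy (liftS (liftS (liftS σ))) C) (subTm (liftS σ) d)
        (subTm σ a) (subTm σ b) (subTm σ p)
    subTm σ ze               = ze
    subTm σ (su k)           = su (subTm σ k)
    subTm σ (natrec C z s k) =
      natrec (subTy (liftS σ) C) (subTm σ z) (subTm (liftS (liftS σ)) s) (subTm σ k)

  sub1 : ∀ {n} → Tm n → Sub (suc n) n
  sub1 a zero    = a
  sub1 a (suc x) = var x

  sub2 : ∀ {n} → Tm n → Tm n → Sub (suc (suc n)) n
  sub2 a b zero          = b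
  sub2 a b (suc zero)    = a
  sub2 a b (suc (suc x)) = var x

  sub3 : ∀ {n} → Tm n → Tm n → Tm n → Sub (suc (suc (suc n))) n
  sub3 a b p zero                = p
  sub3 a b p (suc zero)          = b
  sub3 a b p (suc (suc zero))    = a
  sub3 a b p (suc (suc (suc x))) = var x

  _[_] : ∀ {n} → Ty (suc n) → Tm n → Ty n
  C [ a ] = subTy (sub1 a) C

  -- C(pair(x,y)) in context Γ, x:A, y:B
  σsplit : ∀ {n} → Ty n → Ty (suc n) → Sub (suc n) (suc (suc n))
  σsplit A B zero    = pair (wkTy (wkTy A)) (renTy (liftR (λ x → suc (suc x))) B) (var (suc zero)) (var zero)
  σsplit A B (suc x) = var (suc (suc x))

  -- C(x,x,r(x)) in context Γ, x:A
  σJ : ∀ {n} → Ty n → Sub (suc (suc (suc n))) (suc n)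
  σJ A zero                = rfl (wkTy A) (var zero)
  σJ A (suc zero)          = var zero
  σJ A (suc (suc zero))    = var zero
  σJ A (suc (suc (suc x))) = var (suc x)

  -- C(suc x) in context Γ, x:ℕ, y:C(x)
  σN : ∀ {n} → Sub (suc n) (suc (suc n))
  σN zero    = su (var (suc zero))
  σN (suc x) = var (suc (suc x))

  cellTy : ∀ {n} (k : ℕ) → G.Cell k → Ty n
  cellTy zero    α = BaseT
  cellTy (suc k) α = IdT (cellTy k (G.s α)) (cst k (G.s α)) (cst k (G.t α))

  data Ctx : ℕ → Set where
    ε   : Ctx zero
    _▷_ : ∀ {n} → Ctx n → Ty n → Ctx (suc n)

  lookup : ∀ {n} → Ctx n → Fin n → Ty n
  lookup (Γ ▷ A) zero    = wkTy A
  lookup (Γ ▷ A) (suc x) = wkTy (lookup Γ x)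

  infix 4 ⊢_ _⊢ty_ _⊢_∶_ _⊢_≐ty_ _⊢_≐_∶_

  mutual
    data ⊢_ : ∀ {n} → Ctx n → Set where
      ⊢ε : ⊢ ε
      ⊢▷ : ∀ {n} {Γ : Ctx n} {A} → ⊢ Γ → Γ ⊢ty A → ⊢ (Γ ▷ A)

    data _⊢ty_ {n} (Γ : Ctx n) : Ty n → Set where
      Nat-ty  : ⊢ Γ → Γ ⊢ty NatT
      Base-ty : ⊢ Γ → Γ ⊢ty BaseT
      Π-ty    : ∀ {A B} → Γ ⊢ty A → (Γ ▷ A) ⊢ty B → Γ ⊢ty ΠT A B
      Σ-ty    : ∀ {A B} → Γ ⊢ty A → (Γ ▷ A) ⊢ty B → Γ ⊢ty ΣT A B
      Id-ty   : ∀ {A a b} → Γ ⊢ty A → Γ ⊢ a ∶ A → Γ ⊢ b ∶ A → Γ ⊢ty IdT A a b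

    data _⊢_∶_ {n} (Γ : Ctx n) : Tm n → Ty n → Set where
      var-tm : ∀ {x} → ⊢ Γ → Γ ⊢ var x ∶ lookup Γ x
      cst-tm : ∀ {k α} → ⊢ Γ → Γ ⊢ cst k α ∶ cellTy k α
      lam-tm : ∀ {A B t} → Γ ⊢ty A → (Γ ▷ A) ⊢ t ∶ B → Γ ⊢ lam A B t ∶ ΠT A B
      app-tm : ∀ {A B t u} → (Γ ▷ A) ⊢ty B → Γ ⊢ t ∶ ΠT A B → Γ ⊢ u ∶ A
             → Γ ⊢ app A B t u ∶ B [ u ]
      pair-tm : ∀ {A B a b} → (Γ ▷ A) ⊢ty B → Γ ⊢ a ∶ A → Γ ⊢ b ∶ B [ a ]
              → Γ ⊢ pair A B a b ∶ ΣT A B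
      split-tm : ∀ {A B C d p} → (Γ ▷ ΣT A B) ⊢ty C
               → ((Γ ▷ A) ▷ B) ⊢ d ∶ subTy (σsplit A B) C
               → Γ ⊢ p ∶ ΣT A B
               → Γ ⊢ split A B C d p ∶ C [ p ]
      rfl-tm : ∀ {A a} → Γ ⊢ a ∶ A → Γ ⊢ rfl A a ∶ IdT A a a
      J-tm : ∀ {A C d a b p}
           → (((Γ ▷ A) ▷ wkTy A) ▷ IdT (wkTy (wkTy A)) (var (suc zero)) (var zero)) ⊢ty C
           → (Γ ▷ A) ⊢ d ∶ subTy (σJ A) C
           → Γ ⊢ p ∶ IdT A a b
           → Γ ⊢ J A C d a b p ∶ subTy (sub3 a b p) C
      ze-tm : ⊢ Γ → Γ ⊢ ze ∶ NatT
      su-tm : ∀ {k} → Γ ⊢ k ∶ NatT → Γ ⊢ su k ∶ NatT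
      natrec-tm : ∀ {C z s k} → (Γ ▷ NatT) ⊢ty C
                → Γ ⊢ z ∶ C [ ze ]
                → ((Γ ▷ NatT) ▷ C) ⊢ s ∶ subTy σN C
                → Γ ⊢ k ∶ NatT
                → Γ ⊢ natrec C z s k ∶ C [ k ]
      conv-tm : ∀ {t A B} → Γ ⊢ t ∶ A → Γ ⊢ A ≐ty B → Γ ⊢ t ∶ B

    data _⊢_≐ty_ {n} (Γ : Ctx n) : Ty n → Ty n → Set where
      ty-refl  : ∀ {A} → Γ ⊢ty A → Γ ⊢ A ≐ty A
      ty-sym   : ∀ {A B} → Γ ⊢ A ≐ty B → Γ ⊢ B ≐ty A
      ty-trans : ∀ {A B C} → Γ ⊢ A ≐ty B → Γ ⊢ B ≐ty C → Γ ⊢ A ≐ty C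
      Π-cong   : ∀ {A A' B B'} → Γ ⊢ty A → Γ ⊢ A ≐ty A' → (Γ ▷ A) ⊢ B ≐ty B'
               → Γ ⊢ ΠT A B ≐ty ΠT A' B'
      Σ-cong   : ∀ {A A' B B'} → Γ ⊢ty A → Γ ⊢ A ≐ty A' → (Γ ▷ A) ⊢ B ≐ty B'
               → Γ ⊢ ΣT A B ≐ty ΣT A' B'
      Id-cong  : ∀ {A A' a a' b b'} → Γ ⊢ A ≐ty A' → Γ ⊢ a ≐ a' ∶ A → Γ ⊢ b ≐ b' ∶ A
               → Γ ⊢ IdT A a b ≐ty IdT A' a' b'

    data _⊢_≐_∶_ {n} (Γ : Ctx n) : Tm n → Tm n → Ty n → Set where
      tm-refl  : ∀ {t A} → Γ ⊢ t ∶ A → Γ ⊢ t ≐ t ∶ A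
      tm-sym   : ∀ {t u A} → Γ ⊢ t ≐ u ∶ A → Γ ⊢ u ≐ t ∶ A
      tm-trans : ∀ {t u v A} → Γ ⊢ t ≐ u ∶ A → Γ ⊢ u ≐ v ∶ A → Γ ⊢ t ≐ v ∶ A
      tm-conv  : ∀ {t u A B} → Γ ⊢ t ≐ u ∶ A → Γ ⊢ A ≐ty B → Γ ⊢ t ≐ u ∶ B
      lam-cong : ∀ {A A' B B' t t'} → Γ ⊢ty A → Γ ⊢ A ≐ty A' → (Γ ▷ A) ⊢ B ≐ty B'
               → (Γ ▷ A) ⊢ t ≐ t' ∶ B
               → Γ ⊢ lam A B t ≐ lam A' B' t' ∶ ΠT A B
      app-cong : ∀ {A A' B B' t t' u u'} → Γ ⊢ A ≐ty A' → (Γ ▷ A) ⊢ B ≐ty B'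
               → Γ ⊢ t ≐ t' ∶ ΠT A B → Γ ⊢ u ≐ u' ∶ A
               → Γ ⊢ app A B t u ≐ app A' B' t' u' ∶ B [ u ]
      pair-cong : ∀ {A A' B B' a a' b b'} → Γ ⊢ A ≐ty A' → (Γ ▷ A) ⊢ B ≐ty B'
                → Γ ⊢ a ≐ a' ∶ A → Γ ⊢ b ≐ b' ∶ B [ a ]
                → Γ ⊢ pair A B a b ≐ pair A' B' a' b' ∶ ΣT A B
      split-cong : ∀ {A A' B B' C C' d d' p p'} → Γ ⊢ A ≐ty A' → (Γ ▷ A) ⊢ B ≐ty B'
                 → (Γ ▷ ΣT A B) ⊢ C ≐ty C'
                 → ((Γ ▷ A) ▷ B) ⊢ d ≐ d' ∶ subTy (σsplit A B) C
                 → Γ ⊢ p ≐ p' ∶ ΣT A B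
                 → Γ ⊢ split A B C d p ≐ split A' B' C' d' p' ∶ C [ p ]
      rfl-cong : ∀ {A A' a a'} → Γ ⊢ A ≐ty A' → Γ ⊢ a ≐ a' ∶ A
               → Γ ⊢ rfl A a ≐ rfl A' a' ∶ IdT A a a
      J-cong : ∀ {A A' C C' d d' a a' b b' p p'} → Γ ⊢ A ≐ty A'
             → (((Γ ▷ A) ▷ wkTy A) ▷ IdT (wkTy (wkTy A)) (var (suc zero)) (var zero)) ⊢ C ≐ty C'
             → (Γ ▷ A) ⊢ d ≐ d' ∶ subTy (σJ A) C
             → Γ ⊢ a ≐ a' ∶ A → Γ ⊢ b ≐ b' ∶ A → Γ ⊢ p ≐ p' ∶ IdT A a b
             → Γ ⊢ J A C d a b p ≐ J A' C' d' a' b' p' ∶ subTy (sub3 a b p) C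
      su-cong : ∀ {k k'} → Γ ⊢ k ≐ k' ∶ NatT → Γ ⊢ su k ≐ su k' ∶ NatT
      natrec-cong : ∀ {C C' z z' s s' k k'} → (Γ ▷ NatT) ⊢ C ≐ty C'
                  → Γ ⊢ z ≐ z' ∶ C [ ze ]
                  → ((Γ ▷ NatT) ▷ C) ⊢ s ≐ s' ∶ subTy σN C
                  → Γ ⊢ k ≐ k' ∶ NatT
                  → Γ ⊢ natrec C z s k ≐ natrec C' z' s' k' ∶ C [ k ]
      app-β : ∀ {A B t u} → Γ ⊢ty A → (Γ ▷ A) ⊢ t ∶ B → Γ ⊢ u ∶ A
            → Γ ⊢ app A B (lam A B t) u ≐ subTm (sub1 u) t ∶ B [ u ]
      split-β : ∀ {A B C d a b} → (Γ ▷ ΣT A B) ⊢ty C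
              → ((Γ ▷ A) ▷ B) ⊢ d ∶ subTy (σsplit A B) C
              → (Γ ▷ A) ⊢ty B → Γ ⊢ a ∶ A → Γ ⊢ b ∶ B [ a ]
              → Γ ⊢ split A B C d (pair A B a b) ≐ subTm (sub2 a b) d ∶ C [ pair A B a b ]
      J-β : ∀ {A C d a}
          → (((Γ ▷ A) ▷ wkTy A) ▷ IdT (wkTy (wkTy A)) (var (suc zero)) (var zero)) ⊢ty C
          → (Γ ▷ A) ⊢ d ∶ subTy (σJ A) C
          → Γ ⊢ a ∶ A
          → Γ ⊢ J A C d a a (rfl A a) ≐ subTm (sub1 a) d ∶ subTy (sub3 a a (rfl A a)) C
      natrec-ze : ∀ {C z s} → (Γ ▷ NatT) ⊢ty C → Γ ⊢ z ∶ C [ ze ]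
                → ((Γ ▷ NatT) ▷ C) ⊢ s ∶ subTy σN C
                → Γ ⊢ natrec C z s ze ≐ z ∶ C [ ze ]
      natrec-su : ∀ {C z s k} → (Γ ▷ NatT) ⊢ty C → Γ ⊢ z ∶ C [ ze ]
                → ((Γ ▷ NatT) ▷ C) ⊢ s ∶ subTy σN C → Γ ⊢ k ∶ NatT
                → Γ ⊢ natrec C z s (su k) ≐ subTm (sub2 k (natrec C z s k)) s ∶ C [ su k ]
      reflection : ∀ {A a b p} → Γ ⊢ p ∶ IdT A a b → Γ ⊢ a ≐ b ∶ A
      cst-i : ∀ {k α} → ⊢ Γ
            → Γ ⊢ cst (suc k) (G.i α) ≐ rfl (cellTy k α) (cst k α)
                  ∶ IdT (cellTy k α) (cst k α) (cst k α)

  -- T₀(G): 0-cells are closed terms of type ⌜G⌝; (n+1)-cells are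
  -- (α⃗; β₀, β₁; γ) with (α⃗;β₀),(α⃗;β₁) n-cells and γ : Id(β₀,β₁);
  -- everything up to definitional equality.

  -- Pre n : the "boundary data" α⃗ of an n-cell; PreTy: the type of its top term.
  mutual
    Pre : ℕ → Set
    Pre zero    = ⊤
    Pre (suc n) = Σ (Pre n) λ p → Σ (Tm zero) λ b₀ → Σ (Tm zero) λ b₁ →
                    (ε ⊢ b₀ ∶ PreTy p) × (ε ⊢ b₁ ∶ PreTy p)

    PreTy : ∀ {n} → Pre n → Ty zero
    PreTy {zero}  _                 = BaseT
    PreTy {suc n} (p , b₀ , b₁ , _) = IdT (PreTy p) b₀ b₁

  T₀Cell : ℕ → Set
  T₀Cell n = Σ (Pre n) λ p → Σ (Tm zero) λ b → ε ⊢ b ∶ PreTy p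

  PreEq : ∀ {n} → Pre n → Pre n → Set
  PreEq {zero}  _ _ = ⊤
  PreEq {suc n} (p , b₀ , b₁ , _) (p' , b₀' , b₁' , _) =
    PreEq p p' × (ε ⊢ b₀ ≐ b₀' ∶ PreTy p) × (ε ⊢ b₁ ≐ b₁' ∶ PreTy p)

  CellEq : ∀ {n} → T₀Cell n → T₀Cell n → Set
  CellEq (p , b , _) (p' , b' , _) = PreEq p p' × (ε ⊢ b ≐ b' ∶ PreTy p)

  PreEq⇒ty : ∀ {n} {p p' : Pre n} → PreEq p p' → ε ⊢ PreTy p ≐ty PreTy p'
  PreEq⇒ty {zero}  _              = ty-refl (Base-ty ⊢ε)
  PreEq⇒ty {suc n} (e , e₀ , e₁) = Id-cong (PreEq⇒ty e) e₀ e₁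

  PreEq-refl : ∀ {n} (p : Pre n) → PreEq p p
  PreEq-refl {zero}  _                   = tt
  PreEq-refl {suc n} (p , _ , _ , d₀ , d₁) = PreEq-refl p , tm-refl d₀ , tm-refl d₁

  PreEq-sym : ∀ {n} {p p' : Pre n} → PreEq p p' → PreEq p' p
  PreEq-sym {zero}  _ = tt
  PreEq-sym {suc n} (e , e₀ , e₁) =
    PreEq-sym e , tm-conv (tm-sym e₀) (PreEq⇒ty e) , tm-conv (tm-sym e₁) (PreEq⇒ty e)

  PreEq-trans : ∀ {n} {p p' p'' : Pre n} → PreEq p p' → PreEq p' p'' → PreEq p p''
  PreEq-trans {zero}  _ _ = tt
  PreEq-trans {suc n} (e , e₀ , e₁) (f , f₀ , f₁) =
    PreEq-trans e f ,
    tm-trans e₀ (tm-conv f₀ (ty-sym (PreEq⇒ty e))) ,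
    tm-trans e₁ (tm-conv f₁ (ty-sym (PreEq⇒ty e)))

  CellEq-isEq : ∀ {n} → IsEquivalence (CellEq {n})
  CellEq-isEq = record
    { refl  = λ { {p , b , d} → PreEq-refl p , tm-refl d }
    ; sym   = λ { (e , f) → PreEq-sym e , tm-conv (tm-sym f) (PreEq⇒ty e) }
    ; trans = λ { (e , f) (e' , f') →
                  PreEq-trans e e' , tm-trans f (tm-conv f' (ty-sym (PreEq⇒ty e))) } }

  T₀src : ∀ {n} → T₀Cell (suc n) → T₀Cell n
  T₀src ((p , b₀ , b₁ , d₀ , d₁) , _) = p , b₀ , d₀

  T₀tgt : ∀ {n} → T₀Cell (suc n) → T₀Cell n
  T₀tgt ((p , b₀ , b₁ , d₀ , d₁) , _) = p , b₁ , d₁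

  T₀idc : ∀ {n} → T₀Cell n → T₀Cell (suc n)
  T₀idc (p , b , d) = (p , b , b , d , d) , rfl (PreTy p) b , rfl-tm d

  T₀ : SRGS
  T₀ = record
    { Cell = T₀Cell
    ; _≈_ = CellEq
    ; isEq = CellEq-isEq
    ; src = T₀src ; tgt = T₀tgt ; idc = T₀idc
    ; src-cong = λ { ((e , e₀ , e₁) , _) → e , e₀ }
    ; tgt-cong = λ { ((e , e₀ , e₁) , _) → e , e₁ }
    ; idc-cong = λ { (e , f) → (e , f , f) , rfl-cong (PreEq⇒ty e) f }
    ; ss≈st = λ x → IsEquivalence.refl CellEq-isEq {x = T₀src (T₀src x)}
    ; ts≈tt = λ x → IsEquivalence.refl CellEq-isEq {x = T₀tgt (T₀src x)}
    ; si≈id = λ x → IsEquivalence.refl CellEq-isEq {x = x}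
    ; ti≈id = λ x → IsEquivalence.refl CellEq-isEq {x = x} }

T₀ : RGlob → SRGS
T₀ G = TT.T₀ G

-- In extensional type theory the reflection rule turns a proof γ : Id(a, b) into a
-- definitional equality a = b, and J applied to the motive Id(p, r(x)) (well typed only
-- thanks to reflection) shows γ = r(a), i.e. uniqueness of identity proofs. Hence every
-- (n+1)-cell (α⃗; β₀, β₁; γ) of T₀(G) has β₀ = β₁ and γ = r(β₀): it is the identity on its
-- source. A reflexive globular set in which every cell of positive dimension is the
-- identity on its source is isomorphic to Δ of its set of 0-cells, via iterated sources
-- and iterated identities.
module Submission where

open import Defs
open import Level using (0ℓ)
open import Data.Nat using (ℕ; zero; suc; _+_)
open import Data.Fin using (zero; suc)
open import Data.Product using (_,_)
open import Function using (_∘_)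
open import Relation.Binary using (Setoid; IsEquivalence)
open import Relation.Binary.PropositionalEquality
  using (_≡_; refl; sym; trans; cong; cong₂; subst; module ≡-Reasoning)

cong₃ : ∀ {A B C D : Set} (f : A → B → C → D) {a a' b b' c c'}
      → a ≡ a' → b ≡ b' → c ≡ c' → f a b c ≡ f a' b' c'
cong₃ f refl refl refl = refl

cong₄ : ∀ {A B C D E : Set} (f : A → B → C → D → E) {a a' b b' c c' d d'}
      → a ≡ a' → b ≡ b' → c ≡ c' → d ≡ d' → f a b c d ≡ f a' b' c' d'
cong₄ f refl refl refl refl = refl

cong₅ : ∀ {A B C D E F : Set} (f : A → B → C → D → E → F) {a a' b b' c c' d d' e e'}
      → a ≡ a' → b ≡ b' → c ≡ c' → d ≡ d' → e ≡ e' → f a b c d e ≡ f a' b' c' d' e'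
cong₅ f refl refl refl refl refl = refl

cong₆ : ∀ {A B C D E F H : Set} (f : A → B → C → D → E → F → H)
          {a a' b b' c c' d d' e e' g g'}
      → a ≡ a' → b ≡ b' → c ≡ c' → d ≡ d' → e ≡ e' → g ≡ g'
      → f a b c d e g ≡ f a' b' c' d' e' g'
cong₆ f refl refl refl refl refl refl = refl

module Degenerate (X : SRGS) where
  open SRGS X
  open module ≈ {n} = IsEquivalence (isEq {n})
    using () renaming (refl to ≈-refl; sym to ≈-sym; trans to ≈-trans)

  Cell₀ : Setoid 0ℓ 0ℓ
  Cell₀ = record { Carrier = Cell 0 ; _≈_ = _≈_ ; isEquivalence = isEq }

  srcⁿ : ∀ n → Cell n → Cell 0
  srcⁿ zero    x = x
  srcⁿ (suc n) x = srcⁿ n (src x)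

  idcⁿ : ∀ n → Cell 0 → Cell n
  idcⁿ zero    a = a
  idcⁿ (suc n) a = idc (idcⁿ n a)

  srcⁿ-cong : ∀ n {x y : Cell n} → x ≈ y → srcⁿ n x ≈ srcⁿ n y
  srcⁿ-cong zero    e = e
  srcⁿ-cong (suc n) e = srcⁿ-cong n (src-cong e)

  idcⁿ-cong : ∀ n {a b : Cell 0} → a ≈ b → idcⁿ n a ≈ idcⁿ n b
  idcⁿ-cong zero    e = e
  idcⁿ-cong (suc n) e = idc-cong (idcⁿ-cong n e)

  srcⁿ-idcⁿ : ∀ n (a : Cell 0) → srcⁿ n (idcⁿ n a) ≈ a
  srcⁿ-idcⁿ zero    a = ≈-refl
  srcⁿ-idcⁿ (suc n) a = ≈-trans (srcⁿ-cong n (si≈id (idcⁿ n a))) (srcⁿ-idcⁿ n a)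

  idcⁿ-hom : Hom (Δ Cell₀) X
  idcⁿ-hom = record
    { map      = λ {n} → idcⁿ n
    ; map-cong = λ {n} → idcⁿ-cong n
    ; map-src  = λ a → ≈-sym (si≈id _)
    ; map-tgt  = λ a → ≈-sym (ti≈id _)
    ; map-idc  = λ a → ≈-refl }

  module _ (idc-src≈id : ∀ {n} (x : Cell (suc n)) → idc (src x) ≈ x) where

    tgt≈src : ∀ {n} (x : Cell (suc n)) → tgt x ≈ src x
    tgt≈src x = ≈-trans (tgt-cong (≈-sym (idc-src≈id x))) (ti≈id (src x))

    srcⁿ-hom : Hom X (Δ Cell₀)
    srcⁿ-hom = record
      { map      = λ {n} → srcⁿ n
      ; map-cong = λ {n} → srcⁿ-cong n
      ; map-src  = λ x → ≈-refl
      ; map-tgt  = λ {n} x → srcⁿ-cong n (tgt≈src x)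
      ; map-idc  = λ {n} x → srcⁿ-cong n (si≈id x) }

    idcⁿ-srcⁿ : ∀ n (x : Cell n) → idcⁿ n (srcⁿ n x) ≈ x
    idcⁿ-srcⁿ zero    x = ≈-refl
    idcⁿ-srcⁿ (suc n) x = ≈-trans (idc-cong (idcⁿ-srcⁿ n (src x))) (idc-src≈id x)

    degenerate⇒constant : IsConstant X
    degenerate⇒constant = Cell₀ , record
      { to      = srcⁿ-hom
      ; from    = idcⁿ-hom
      ; from-to = λ {n} → idcⁿ-srcⁿ n
      ; to-from = λ {n} → srcⁿ-idcⁿ n }

module Metatheory (G : RGlob) where
  open TT G

  liftS-liftR : ∀ {n m k} {ρ : Ren n m} {σ : Sub m k} {τ : Sub n k}
              → (∀ x → σ (ρ x) ≡ τ x) → ∀ x → liftS σ (liftR ρ x) ≡ liftS τ x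
  liftS-liftR h zero    = refl
  liftS-liftR h (suc x) = cong wkTm (h x)

  mutual
    subTy-renTy : ∀ {n m k} {ρ : Ren n m} {σ : Sub m k} {τ : Sub n k}
                → (∀ x → σ (ρ x) ≡ τ x) → ∀ A → subTy σ (renTy ρ A) ≡ subTy τ A
    subTy-renTy h (ΠT A B)    = cong₂ ΠT (subTy-renTy h A) (subTy-renTy (liftS-liftR h) B)
    subTy-renTy h (ΣT A B)    = cong₂ ΣT (subTy-renTy h A) (subTy-renTy (liftS-liftR h) B)
    subTy-renTy h (IdT A a b) = cong₃ IdT (subTy-renTy h A) (subTm-renTm h a) (subTm-renTm h b)
    subTy-renTy h NatT        = refl
    subTy-renTy h BaseT       = refl

    subTm-renTm : ∀ {n m k} {ρ : Ren n m} {σ : Sub m k} {τ : Sub n k}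
                → (∀ x → σ (ρ x) ≡ τ x) → ∀ t → subTm σ (renTm ρ t) ≡ subTm τ t
    subTm-renTm h (var x)           = h x
    subTm-renTm h (cst k α)         = refl
    subTm-renTm h (lam A B t)       =
      cong₃ lam (subTy-renTy h A) (subTy-renTy (liftS-liftR h) B) (subTm-renTm (liftS-liftR h) t)
    subTm-renTm h (app A B t u)     =
      cong₄ app (subTy-renTy h A) (subTy-renTy (liftS-liftR h) B) (subTm-renTm h t) (subTm-renTm h u)
    subTm-renTm h (pair A B t u)    =
      cong₄ pair (subTy-renTy h A) (subTy-renTy (liftS-liftR h) B) (subTm-renTm h t) (subTm-renTm h u)
    subTm-renTm h (split A B C d p) =
      cong₅ split (subTy-renTy h A) (subTy-renTy (liftS-liftR h) B) (subTy-renTy (liftS-liftR h) C)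
                  (subTm-renTm (liftS-liftR (liftS-liftR h)) d) (subTm-renTm h p)
    subTm-renTm h (rfl A a)         = cong₂ rfl (subTy-renTy h A) (subTm-renTm h a)
    subTm-renTm h (J A C d a b p)   =
      cong₆ J (subTy-renTy h A) (subTy-renTy (liftS-liftR (liftS-liftR (liftS-liftR h))) C)
              (subTm-renTm (liftS-liftR h) d) (subTm-renTm h a) (subTm-renTm h b) (subTm-renTm h p)
    subTm-renTm h ze                = refl
    subTm-renTm h (su k)            = cong su (subTm-renTm h k)
    subTm-renTm h (natrec C z s k)  =
      cong₄ natrec (subTy-renTy (liftS-liftR h) C) (subTm-renTm h z)
                   (subTm-renTm (liftS-liftR (liftS-liftR h)) s) (subTm-renTm h k)

  liftS-var : ∀ {n m} {σ : Sub n m} {ρ : Ren n m}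
            → (∀ x → σ x ≡ var (ρ x)) → ∀ x → liftS σ x ≡ var (liftR ρ x)
  liftS-var h zero    = refl
  liftS-var h (suc x) = cong wkTm (h x)

  mutual
    subTy-var : ∀ {n m} {σ : Sub n m} {ρ : Ren n m}
              → (∀ x → σ x ≡ var (ρ x)) → ∀ A → subTy σ A ≡ renTy ρ A
    subTy-var h (ΠT A B)    = cong₂ ΠT (subTy-var h A) (subTy-var (liftS-var h) B)
    subTy-var h (ΣT A B)    = cong₂ ΣT (subTy-var h A) (subTy-var (liftS-var h) B)
    subTy-var h (IdT A a b) = cong₃ IdT (subTy-var h A) (subTm-var h a) (subTm-var h b)
    subTy-var h NatT        = refl
    subTy-var h BaseT       = refl

    subTm-var : ∀ {n m} {σ : Sub n m} {ρ : Ren n m}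
              → (∀ x → σ x ≡ var (ρ x)) → ∀ t → subTm σ t ≡ renTm ρ t
    subTm-var h (var x)           = h x
    subTm-var h (cst k α)         = refl
    subTm-var h (lam A B t)       =
      cong₃ lam (subTy-var h A) (subTy-var (liftS-var h) B) (subTm-var (liftS-var h) t)
    subTm-var h (app A B t u)     =
      cong₄ app (subTy-var h A) (subTy-var (liftS-var h) B) (subTm-var h t) (subTm-var h u)
    subTm-var h (pair A B t u)    =
      cong₄ pair (subTy-var h A) (subTy-var (liftS-var h) B) (subTm-var h t) (subTm-var h u)
    subTm-var h (split A B C d p) =
      cong₅ split (subTy-var h A) (subTy-var (liftS-var h) B) (subTy-var (liftS-var h) C)
                  (subTm-var (liftS-var (liftS-var h)) d) (subTm-var h p)
    subTm-var h (rfl A a)         = cong₂ rfl (subTy-var h A) (subTm-var h a)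
    subTm-var h (J A C d a b p)   =
      cong₆ J (subTy-var h A) (subTy-var (liftS-var (liftS-var (liftS-var h))) C)
              (subTm-var (liftS-var h) d) (subTm-var h a) (subTm-var h b) (subTm-var h p)
    subTm-var h ze                = refl
    subTm-var h (su k)            = cong su (subTm-var h k)
    subTm-var h (natrec C z s k)  =
      cong₄ natrec (subTy-var (liftS-var h) C) (subTm-var h z)
                   (subTm-var (liftS-var (liftS-var h)) s) (subTm-var h k)

  liftS-id : ∀ {n} {σ : Sub n n} → (∀ x → σ x ≡ var x) → ∀ x → liftS σ x ≡ var x
  liftS-id h zero    = refl
  liftS-id h (suc x) = cong wkTm (h x)

  mutual
    subTy-id : ∀ {n} {σ : Sub n n} → (∀ x → σ x ≡ var x) → ∀ A → subTy σ A ≡ A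
    subTy-id h (ΠT A B)    = cong₂ ΠT (subTy-id h A) (subTy-id (liftS-id h) B)
    subTy-id h (ΣT A B)    = cong₂ ΣT (subTy-id h A) (subTy-id (liftS-id h) B)
    subTy-id h (IdT A a b) = cong₃ IdT (subTy-id h A) (subTm-id h a) (subTm-id h b)
    subTy-id h NatT        = refl
    subTy-id h BaseT       = refl

    subTm-id : ∀ {n} {σ : Sub n n} → (∀ x → σ x ≡ var x) → ∀ t → subTm σ t ≡ t
    subTm-id h (var x)           = h x
    subTm-id h (cst k α)         = refl
    subTm-id h (lam A B t)       =
      cong₃ lam (subTy-id h A) (subTy-id (liftS-id h) B) (subTm-id (liftS-id h) t)
    subTm-id h (app A B t u)     =
      cong₄ app (subTy-id h A) (subTy-id (liftS-id h) B) (subTm-id h t) (subTm-id h u)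
    subTm-id h (pair A B t u)    =
      cong₄ pair (subTy-id h A) (subTy-id (liftS-id h) B) (subTm-id h t) (subTm-id h u)
    subTm-id h (split A B C d p) =
      cong₅ split (subTy-id h A) (subTy-id (liftS-id h) B) (subTy-id (liftS-id h) C)
                  (subTm-id (liftS-id (liftS-id h)) d) (subTm-id h p)
    subTm-id h (rfl A a)         = cong₂ rfl (subTy-id h A) (subTm-id h a)
    subTm-id h (J A C d a b p)   =
      cong₆ J (subTy-id h A) (subTy-id (liftS-id (liftS-id (liftS-id h))) C)
              (subTm-id (liftS-id h) d) (subTm-id h a) (subTm-id h b) (subTm-id h p)
    subTm-id h ze                = refl
    subTm-id h (su k)            = cong su (subTm-id h k)
    subTm-id h (natrec C z s k)  =
      cong₄ natrec (subTy-id (liftS-id h) C) (subTm-id h z)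
                   (subTm-id (liftS-id (liftS-id h)) s) (subTm-id h k)

  -- Obtained by viewing renamings as substitutions by variables.
  renTy-renTy : ∀ {n m k} {ρ : Ren n m} {ρ' : Ren m k} {τ : Ren n k}
              → (∀ x → ρ' (ρ x) ≡ τ x) → ∀ A → renTy ρ' (renTy ρ A) ≡ renTy τ A
  renTy-renTy {ρ = ρ} {ρ'} {τ} h A = begin
    renTy ρ' (renTy ρ A)         ≡⟨ sym (subTy-var (λ _ → refl) (renTy ρ A)) ⟩
    subTy (var ∘ ρ') (renTy ρ A) ≡⟨ subTy-renTy (cong var ∘ h) A ⟩
    subTy (var ∘ τ) A            ≡⟨ subTy-var (λ _ → refl) A ⟩
    renTy τ A                    ∎
    where open ≡-Reasoning

  renTm-renTm : ∀ {n m k} {ρ : Ren n m} {ρ' : Ren m k} {τ : Ren n k}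
              → (∀ x → ρ' (ρ x) ≡ τ x) → ∀ t → renTm ρ' (renTm ρ t) ≡ renTm τ t
  renTm-renTm {ρ = ρ} {ρ'} {τ} h t = begin
    renTm ρ' (renTm ρ t)         ≡⟨ sym (subTm-var (λ _ → refl) (renTm ρ t)) ⟩
    subTm (var ∘ ρ') (renTm ρ t) ≡⟨ subTm-renTm (cong var ∘ h) t ⟩
    subTm (var ∘ τ) t            ≡⟨ subTm-var (λ _ → refl) t ⟩
    renTm τ t                    ∎
    where open ≡-Reasoning

  renTy-wkTy : ∀ {n m} (ρ : Ren n m) A → renTy (liftR ρ) (wkTy A) ≡ wkTy (renTy ρ A)
  renTy-wkTy ρ A = trans (renTy-renTy (λ _ → refl) A) (sym (renTy-renTy (λ _ → refl) A))

  renTm-wkTm : ∀ {n m} (ρ : Ren n m) t → renTm (liftR ρ) (wkTm t) ≡ wkTm (renTm ρ t)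
  renTm-wkTm ρ t = trans (renTm-renTm (λ _ → refl) t) (sym (renTm-renTm (λ _ → refl) t))

  liftR-liftS : ∀ {n m k} {σ : Sub n m} {ρ : Ren m k} {τ : Sub n k}
              → (∀ x → renTm ρ (σ x) ≡ τ x) → ∀ x → renTm (liftR ρ) (liftS σ x) ≡ liftS τ x
  liftR-liftS h zero                = refl
  liftR-liftS {σ = σ} {ρ} h (suc x) = trans (renTm-wkTm ρ (σ x)) (cong wkTm (h x))

  mutual
    renTy-subTy : ∀ {n m k} {σ : Sub n m} {ρ : Ren m k} {τ : Sub n k}
                → (∀ x → renTm ρ (σ x) ≡ τ x) → ∀ A → renTy ρ (subTy σ A) ≡ subTy τ A
    renTy-subTy h (ΠT A B)    = cong₂ ΠT (renTy-subTy h A) (renTy-subTy (liftR-liftS h) B)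
    renTy-subTy h (ΣT A B)    = cong₂ ΣT (renTy-subTy h A) (renTy-subTy (liftR-liftS h) B)
    renTy-subTy h (IdT A a b) = cong₃ IdT (renTy-subTy h A) (renTm-subTm h a) (renTm-subTm h b)
    renTy-subTy h NatT        = refl
    renTy-subTy h BaseT       = refl

    renTm-subTm : ∀ {n m k} {σ : Sub n m} {ρ : Ren m k} {τ : Sub n k}
                → (∀ x → renTm ρ (σ x) ≡ τ x) → ∀ t → renTm ρ (subTm σ t) ≡ subTm τ t
    renTm-subTm h (var x)           = h x
    renTm-subTm h (cst k α)         = refl
    renTm-subTm h (lam A B t)       =
      cong₃ lam (renTy-subTy h A) (renTy-subTy (liftR-liftS h) B) (renTm-subTm (liftR-liftS h) t)
    renTm-subTm h (app A B t u)     =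
      cong₄ app (renTy-subTy h A) (renTy-subTy (liftR-liftS h) B) (renTm-subTm h t) (renTm-subTm h u)
    renTm-subTm h (pair A B t u)    =
      cong₄ pair (renTy-subTy h A) (renTy-subTy (liftR-liftS h) B) (renTm-subTm h t) (renTm-subTm h u)
    renTm-subTm h (split A B C d p) =
      cong₅ split (renTy-subTy h A) (renTy-subTy (liftR-liftS h) B) (renTy-subTy (liftR-liftS h) C)
                  (renTm-subTm (liftR-liftS (liftR-liftS h)) d) (renTm-subTm h p)
    renTm-subTm h (rfl A a)         = cong₂ rfl (renTy-subTy h A) (renTm-subTm h a)
    renTm-subTm h (J A C d a b p)   =
      cong₆ J (renTy-subTy h A) (renTy-subTy (liftR-liftS (liftR-liftS (liftR-liftS h))) C)
              (renTm-subTm (liftR-liftS h) d) (renTm-subTm h a) (renTm-subTm h b) (renTm-subTm h p)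
    renTm-subTm h ze                = refl
    renTm-subTm h (su k)            = cong su (renTm-subTm h k)
    renTm-subTm h (natrec C z s k)  =
      cong₄ natrec (renTy-subTy (liftR-liftS h) C) (renTm-subTm h z)
                   (renTm-subTm (liftR-liftS (liftR-liftS h)) s) (renTm-subTm h k)

  renTy-subTy-commute : ∀ {n m n' m'} {σ : Sub n m} {ρ : Ren m m'} {ρ' : Ren n n'} {σ' : Sub n' m'}
                      → (∀ x → renTm ρ (σ x) ≡ σ' (ρ' x))
                      → ∀ A → renTy ρ (subTy σ A) ≡ subTy σ' (renTy ρ' A)
  renTy-subTy-commute h A = trans (renTy-subTy h A) (sym (subTy-renTy (λ _ → refl) A))

  renTm-subTm-commute : ∀ {n m n' m'} {σ : Sub n m} {ρ : Ren m m'} {ρ' : Ren n n'} {σ' : Sub n' m'}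
                      → (∀ x → renTm ρ (σ x) ≡ σ' (ρ' x))
                      → ∀ t → renTm ρ (subTm σ t) ≡ subTm σ' (renTm ρ' t)
  renTm-subTm-commute h t = trans (renTm-subTm h t) (sym (subTm-renTm (λ _ → refl) t))

  renTy-wkTy² : ∀ {n m} (ρ : Ren n m) A
              → renTy (liftR (liftR ρ)) (wkTy (wkTy A)) ≡ wkTy (wkTy (renTy ρ A))
  renTy-wkTy² ρ A = trans (renTy-wkTy (liftR ρ) (wkTy A)) (cong wkTy (renTy-wkTy ρ A))

  renTy-[] : ∀ {n m} (ρ : Ren n m) u B → renTy ρ (B [ u ]) ≡ renTy (liftR ρ) B [ renTm ρ u ]
  renTy-[] ρ u = renTy-subTy-commute λ { zero → refl ; (suc x) → refl }

  renTm-sub1 : ∀ {n m} (ρ : Ren n m) u t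
             → renTm ρ (subTm (sub1 u) t) ≡ subTm (sub1 (renTm ρ u)) (renTm (liftR ρ) t)
  renTm-sub1 ρ u = renTm-subTm-commute λ { zero → refl ; (suc x) → refl }

  renTm-sub2 : ∀ {n m} (ρ : Ren n m) a b t
             → renTm ρ (subTm (sub2 a b) t)
               ≡ subTm (sub2 (renTm ρ a) (renTm ρ b)) (renTm (liftR (liftR ρ)) t)
  renTm-sub2 ρ a b = renTm-subTm-commute λ { zero → refl ; (suc zero) → refl ; (suc (suc x)) → refl }

  renTy-sub3 : ∀ {n m} (ρ : Ren n m) a b p C
             → renTy ρ (subTy (sub3 a b p) C)
               ≡ subTy (sub3 (renTm ρ a) (renTm ρ b) (renTm ρ p)) (renTy (liftR (liftR (liftR ρ))) C)
  renTy-sub3 ρ a b p = renTy-subTy-commute λ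
    { zero → refl ; (suc zero) → refl ; (suc (suc zero)) → refl ; (suc (suc (suc x))) → refl }

  renTy-σsplit : ∀ {n m} (ρ : Ren n m) A B C
               → renTy (liftR (liftR ρ)) (subTy (σsplit A B) C)
                 ≡ subTy (σsplit (renTy ρ A) (renTy (liftR ρ) B)) (renTy (liftR ρ) C)
  renTy-σsplit ρ A B = renTy-subTy-commute λ
    { zero    → cong₂ (λ A' B' → pair A' B' (var (suc zero)) (var zero))
                      (renTy-wkTy² ρ A)
                      (trans (renTy-renTy {τ = liftR (λ y → suc (suc (ρ y)))}
                                          (λ { zero → refl ; (suc x) → refl }) B)
                             (sym (renTy-renTy (λ { zero → refl ; (suc x) → refl }) B)))
    ; (suc x) → refl }

  renTy-σJ : ∀ {n m} (ρ : Ren n m) A C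
           → renTy (liftR ρ) (subTy (σJ A) C)
             ≡ subTy (σJ (renTy ρ A)) (renTy (liftR (liftR (liftR ρ))) C)
  renTy-σJ ρ A = renTy-subTy-commute λ
    { zero                → cong (λ A' → rfl A' (var zero)) (renTy-wkTy ρ A)
    ; (suc zero)          → refl
    ; (suc (suc zero))    → refl
    ; (suc (suc (suc x))) → refl }

  renTy-σN : ∀ {n m} (ρ : Ren n m) C
           → renTy (liftR (liftR ρ)) (subTy σN C) ≡ subTy σN (renTy (liftR ρ) C)
  renTy-σN ρ = renTy-subTy-commute λ { zero → refl ; (suc x) → refl }

  renTy-cellTy : ∀ {n m} (ρ : Ren n m) k α → renTy ρ (cellTy {n} k α) ≡ cellTy {m} k α
  renTy-cellTy ρ zero    α = refl
  renTy-cellTy ρ (suc k) α =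
    cong (λ A → IdT A (cst k (G.s α)) (cst k (G.t α))) (renTy-cellTy ρ k (G.s α))

  -- Weakening is proved under a telescope Θ of further binders, so that the induction can
  -- pass under the binders of the typing rules; the inserted variable sits just before Θ.
  data Tel (n : ℕ) : ℕ → Set where
    []   : Tel n zero
    _▷▷_ : ∀ {m} → Tel n m → Ty (m + n) → Tel n (suc m)

  _++_ : ∀ {n m} → Ctx n → Tel n m → Ctx (m + n)
  Γ ++ []       = Γ
  Γ ++ (Θ ▷▷ A) = (Γ ++ Θ) ▷ A

  wkUnder : ∀ {n} m → Ren (m + n) (m + suc n)
  wkUnder zero    = suc
  wkUnder (suc m) = liftR (wkUnder m)

  wkTel : ∀ {n m} → Tel n m → Tel (suc n) m
  wkTel []                = []
  wkTel (_▷▷_ {m} Θ A) = wkTel Θ ▷▷ renTy (wkUnder m) A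

  module Weakening {n} {Γ : Ctx n} {B : Ty n} (⊢B : Γ ⊢ty B) where

    lookup-wk : ∀ {m} (Θ : Tel n m) x
              → lookup ((Γ ▷ B) ++ wkTel Θ) (wkUnder m x) ≡ renTy (wkUnder m) (lookup (Γ ++ Θ) x)
    lookup-wk []                   x       = refl
    lookup-wk (_▷▷_ {m} Θ A) zero    = sym (renTy-wkTy (wkUnder m) A)
    lookup-wk (_▷▷_ {m} Θ A) (suc x) =
      trans (cong wkTy (lookup-wk Θ x)) (sym (renTy-wkTy (wkUnder m) (lookup (Γ ++ Θ) x)))

    ctxJ-ren : ∀ {k j} (Δ : Ctx k) (ρ : Ren j k) A
             → ((Δ ▷ renTy ρ A) ▷ renTy (liftR ρ) (wkTy A))
                 ▷ renTy (liftR (liftR ρ)) (IdT (wkTy (wkTy A)) (var (suc zero)) (var zero))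
               ≡ ((Δ ▷ renTy ρ A) ▷ wkTy (renTy ρ A))
                 ▷ IdT (wkTy (wkTy (renTy ρ A))) (var (suc zero)) (var zero)
    ctxJ-ren Δ ρ A = cong₂ _▷_ (cong ((Δ ▷ renTy ρ A) ▷_) (renTy-wkTy ρ A))
                                (cong (λ A' → IdT A' (var (suc zero)) (var zero)) (renTy-wkTy² ρ A))

    castTm : ∀ {k} {Δ : Ctx k} {t T T'} → T ≡ T' → Δ ⊢ t ∶ T → Δ ⊢ t ∶ T'
    castTm refl d = d

    castEq : ∀ {k} {Δ : Ctx k} {t u T T'} → T ≡ T' → Δ ⊢ t ≐ u ∶ T → Δ ⊢ t ≐ u ∶ T'
    castEq refl e = e

    castEq₂ : ∀ {k} {Δ : Ctx k} {t u u' T T'} → u ≡ u' → T ≡ T' → Δ ⊢ t ≐ u ∶ T → Δ ⊢ t ≐ u' ∶ T'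
    castEq₂ refl refl e = e

    castCtx : ∀ {k} {Δ Δ' : Ctx k} {T} → Δ ≡ Δ' → Δ ⊢ty T → Δ' ⊢ty T
    castCtx refl d = d

    castCtxEq : ∀ {k} {Δ Δ' : Ctx k} {T T'} → Δ ≡ Δ' → Δ ⊢ T ≐ty T' → Δ' ⊢ T ≐ty T'
    castCtxEq refl e = e

    mutual
      ⊢-wk : ∀ {m} (Θ : Tel n m) → ⊢ (Γ ++ Θ) → ⊢ ((Γ ▷ B) ++ wkTel Θ)
      ⊢-wk []       ⊢Γ          = ⊢▷ ⊢Γ ⊢B
      ⊢-wk (Θ ▷▷ A) (⊢▷ ⊢Θ ⊢A) = ⊢▷ (⊢-wk Θ ⊢Θ) (⊢ty-wk Θ ⊢A)

      ⊢ty-wk : ∀ {m} (Θ : Tel n m) {A} → (Γ ++ Θ) ⊢ty A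
             → ((Γ ▷ B) ++ wkTel Θ) ⊢ty renTy (wkUnder m) A
      ⊢ty-wk Θ (Nat-ty γ)    = Nat-ty (⊢-wk Θ γ)
      ⊢ty-wk Θ (Base-ty γ)   = Base-ty (⊢-wk Θ γ)
      ⊢ty-wk Θ (Π-ty a b)    = Π-ty (⊢ty-wk Θ a) (⊢ty-wk (Θ ▷▷ _) b)
      ⊢ty-wk Θ (Σ-ty a b)    = Σ-ty (⊢ty-wk Θ a) (⊢ty-wk (Θ ▷▷ _) b)
      ⊢ty-wk Θ (Id-ty a x y) = Id-ty (⊢ty-wk Θ a) (⊢tm-wk Θ x) (⊢tm-wk Θ y)

      ⊢tm-wk : ∀ {m} (Θ : Tel n m) {t A} → (Γ ++ Θ) ⊢ t ∶ A
             → ((Γ ▷ B) ++ wkTel Θ) ⊢ renTm (wkUnder m) t ∶ renTy (wkUnder m) A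
      ⊢tm-wk Θ (var-tm {x} γ) =
        subst (λ T → _ ⊢ var (wkUnder _ x) ∶ T) (lookup-wk Θ x) (var-tm (⊢-wk Θ γ))
      ⊢tm-wk Θ (cst-tm {k} {α} γ) =
        subst (λ T → _ ⊢ cst k α ∶ T) (sym (renTy-cellTy _ k α)) (cst-tm (⊢-wk Θ γ))
      ⊢tm-wk Θ (lam-tm a t) = lam-tm (⊢ty-wk Θ a) (⊢tm-wk (Θ ▷▷ _) t)
      ⊢tm-wk {m} Θ (app-tm {B = B'} {u = u} b t v) =
        castTm (sym (renTy-[] (wkUnder m) u B'))
          (app-tm (⊢ty-wk (Θ ▷▷ _) b) (⊢tm-wk Θ t) (⊢tm-wk Θ v))
      ⊢tm-wk {m} Θ (pair-tm {B = B'} {a = a} b x y) =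
        pair-tm (⊢ty-wk (Θ ▷▷ _) b) (⊢tm-wk Θ x) (castTm (renTy-[] (wkUnder m) a B') (⊢tm-wk Θ y))
      ⊢tm-wk {m} Θ (split-tm {A} {B'} {C} {p = p} c d q) =
        castTm (sym (renTy-[] (wkUnder m) p C))
          (split-tm (⊢ty-wk (Θ ▷▷ _) c)
            (castTm (renTy-σsplit (wkUnder m) A B' C) (⊢tm-wk ((Θ ▷▷ _) ▷▷ _) d))
            (⊢tm-wk Θ q))
      ⊢tm-wk Θ (rfl-tm a) = rfl-tm (⊢tm-wk Θ a)
      ⊢tm-wk {m} Θ (J-tm {A} {C} {a = a} {b} {p} c d q) =
        castTm (sym (renTy-sub3 (wkUnder m) a b p C))
          (J-tm (castCtx (ctxJ-ren _ (wkUnder m) A) (⊢ty-wk (((Θ ▷▷ _) ▷▷ _) ▷▷ _) c))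
                (castTm (renTy-σJ (wkUnder m) A C) (⊢tm-wk (Θ ▷▷ _) d))
                (⊢tm-wk Θ q))
      ⊢tm-wk Θ (ze-tm γ) = ze-tm (⊢-wk Θ γ)
      ⊢tm-wk Θ (su-tm k) = su-tm (⊢tm-wk Θ k)
      ⊢tm-wk {m} Θ (natrec-tm {C} {k = k} c z s q) =
        castTm (sym (renTy-[] (wkUnder m) k C))
          (natrec-tm (⊢ty-wk (Θ ▷▷ _) c)
            (castTm (renTy-[] (wkUnder m) ze C) (⊢tm-wk Θ z))
            (castTm (renTy-σN (wkUnder m) C) (⊢tm-wk ((Θ ▷▷ _) ▷▷ _) s))
            (⊢tm-wk Θ q))
      ⊢tm-wk Θ (conv-tm t e) = conv-tm (⊢tm-wk Θ t) (⊢≐ty-wk Θ e)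

      ⊢≐ty-wk : ∀ {m} (Θ : Tel n m) {A A'} → (Γ ++ Θ) ⊢ A ≐ty A'
              → ((Γ ▷ B) ++ wkTel Θ) ⊢ renTy (wkUnder m) A ≐ty renTy (wkUnder m) A'
      ⊢≐ty-wk Θ (ty-refl a)     = ty-refl (⊢ty-wk Θ a)
      ⊢≐ty-wk Θ (ty-sym e)      = ty-sym (⊢≐ty-wk Θ e)
      ⊢≐ty-wk Θ (ty-trans e f)  = ty-trans (⊢≐ty-wk Θ e) (⊢≐ty-wk Θ f)
      ⊢≐ty-wk Θ (Π-cong a e f)  = Π-cong (⊢ty-wk Θ a) (⊢≐ty-wk Θ e) (⊢≐ty-wk (Θ ▷▷ _) f)
      ⊢≐ty-wk Θ (Σ-cong a e f)  = Σ-cong (⊢ty-wk Θ a) (⊢≐ty-wk Θ e) (⊢≐ty-wk (Θ ▷▷ _) f)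
      ⊢≐ty-wk Θ (Id-cong e x y) = Id-cong (⊢≐ty-wk Θ e) (⊢≐-wk Θ x) (⊢≐-wk Θ y)

      ⊢≐-wk : ∀ {m} (Θ : Tel n m) {t u A} → (Γ ++ Θ) ⊢ t ≐ u ∶ A
            → ((Γ ▷ B) ++ wkTel Θ) ⊢ renTm (wkUnder m) t ≐ renTm (wkUnder m) u ∶ renTy (wkUnder m) A
      ⊢≐-wk Θ (tm-refl t)    = tm-refl (⊢tm-wk Θ t)
      ⊢≐-wk Θ (tm-sym e)     = tm-sym (⊢≐-wk Θ e)
      ⊢≐-wk Θ (tm-trans e f) = tm-trans (⊢≐-wk Θ e) (⊢≐-wk Θ f)
      ⊢≐-wk Θ (tm-conv e f)  = tm-conv (⊢≐-wk Θ e) (⊢≐ty-wk Θ f)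
      ⊢≐-wk Θ (lam-cong a e f g) =
        lam-cong (⊢ty-wk Θ a) (⊢≐ty-wk Θ e) (⊢≐ty-wk (Θ ▷▷ _) f) (⊢≐-wk (Θ ▷▷ _) g)
      ⊢≐-wk {m} Θ (app-cong {B = B'} {u = u} e f g h) =
        castEq (sym (renTy-[] (wkUnder m) u B'))
          (app-cong (⊢≐ty-wk Θ e) (⊢≐ty-wk (Θ ▷▷ _) f) (⊢≐-wk Θ g) (⊢≐-wk Θ h))
      ⊢≐-wk {m} Θ (pair-cong {B = B'} {a = a} e f g h) =
        pair-cong (⊢≐ty-wk Θ e) (⊢≐ty-wk (Θ ▷▷ _) f) (⊢≐-wk Θ g)
          (castEq (renTy-[] (wkUnder m) a B') (⊢≐-wk Θ h))
      ⊢≐-wk {m} Θ (split-cong {A} {B = B'} {C = C} {p = p} e f g h k) =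
        castEq (sym (renTy-[] (wkUnder m) p C))
          (split-cong (⊢≐ty-wk Θ e) (⊢≐ty-wk (Θ ▷▷ _) f) (⊢≐ty-wk (Θ ▷▷ _) g)
            (castEq (renTy-σsplit (wkUnder m) A B' C) (⊢≐-wk ((Θ ▷▷ _) ▷▷ _) h))
            (⊢≐-wk Θ k))
      ⊢≐-wk Θ (rfl-cong e f) = rfl-cong (⊢≐ty-wk Θ e) (⊢≐-wk Θ f)
      ⊢≐-wk {m} Θ (J-cong {A} {C = C} {a = a} {b = b} {p = p} e f g h k l) =
        castEq (sym (renTy-sub3 (wkUnder m) a b p C))
          (J-cong (⊢≐ty-wk Θ e)
            (castCtxEq (ctxJ-ren _ (wkUnder m) A) (⊢≐ty-wk (((Θ ▷▷ _) ▷▷ _) ▷▷ _) f))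
            (castEq (renTy-σJ (wkUnder m) A C) (⊢≐-wk (Θ ▷▷ _) g))
            (⊢≐-wk Θ h) (⊢≐-wk Θ k) (⊢≐-wk Θ l))
      ⊢≐-wk Θ (su-cong e) = su-cong (⊢≐-wk Θ e)
      ⊢≐-wk {m} Θ (natrec-cong {C} {k = k} e f g h) =
        castEq (sym (renTy-[] (wkUnder m) k C))
          (natrec-cong (⊢≐ty-wk (Θ ▷▷ _) e)
            (castEq (renTy-[] (wkUnder m) ze C) (⊢≐-wk Θ f))
            (castEq (renTy-σN (wkUnder m) C) (⊢≐-wk ((Θ ▷▷ _) ▷▷ _) g))
            (⊢≐-wk Θ h))
      ⊢≐-wk {m} Θ (app-β {A} {B'} {t} {u} a t' u') =
        castEq₂ (sym (renTm-sub1 (wkUnder m) u t)) (sym (renTy-[] (wkUnder m) u B'))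
          (app-β (⊢ty-wk Θ a) (⊢tm-wk (Θ ▷▷ _) t') (⊢tm-wk Θ u'))
      ⊢≐-wk {m} Θ (split-β {A} {B'} {C} {d} {a} {b} c d' b' a' b'') =
        castEq₂ (sym (renTm-sub2 (wkUnder m) a b d)) (sym (renTy-[] (wkUnder m) (pair A B' a b) C))
          (split-β (⊢ty-wk (Θ ▷▷ _) c)
            (castTm (renTy-σsplit (wkUnder m) A B' C) (⊢tm-wk ((Θ ▷▷ _) ▷▷ _) d'))
            (⊢ty-wk (Θ ▷▷ _) b') (⊢tm-wk Θ a')
            (castTm (renTy-[] (wkUnder m) a B') (⊢tm-wk Θ b'')))
      ⊢≐-wk {m} Θ (J-β {A} {C} {d} {a} c d' a') =
        castEq₂ (sym (renTm-sub1 (wkUnder m) a d)) (sym (renTy-sub3 (wkUnder m) a a (rfl A a) C))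
          (J-β (castCtx (ctxJ-ren _ (wkUnder m) A) (⊢ty-wk (((Θ ▷▷ _) ▷▷ _) ▷▷ _) c))
               (castTm (renTy-σJ (wkUnder m) A C) (⊢tm-wk (Θ ▷▷ _) d'))
               (⊢tm-wk Θ a'))
      ⊢≐-wk {m} Θ (natrec-ze {C} c z s) =
        castEq (sym (renTy-[] (wkUnder m) ze C))
          (natrec-ze (⊢ty-wk (Θ ▷▷ _) c)
            (castTm (renTy-[] (wkUnder m) ze C) (⊢tm-wk Θ z))
            (castTm (renTy-σN (wkUnder m) C) (⊢tm-wk ((Θ ▷▷ _) ▷▷ _) s)))
      ⊢≐-wk {m} Θ (natrec-su {C} {z} {s} {k} c z' s' k') =
        castEq₂ (sym (renTm-sub2 (wkUnder m) k (natrec C z s k) s)) (sym (renTy-[] (wkUnder m) (su k) C))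
          (natrec-su (⊢ty-wk (Θ ▷▷ _) c)
            (castTm (renTy-[] (wkUnder m) ze C) (⊢tm-wk Θ z'))
            (castTm (renTy-σN (wkUnder m) C) (⊢tm-wk ((Θ ▷▷ _) ▷▷ _) s'))
            (⊢tm-wk Θ k'))
      ⊢≐-wk Θ (reflection p) = reflection (⊢tm-wk Θ p)
      ⊢≐-wk {m} Θ (cst-i {k} {α} γ) =
        subst (λ T → _ ⊢ cst (suc k) (G.i α) ≐ rfl T (cst k α) ∶ IdT T (cst k α) (cst k α))
          (sym (renTy-cellTy (wkUnder m) k α)) (cst-i (⊢-wk Θ γ))

  ⊢ty-wk₁ : ∀ {n} {Γ : Ctx n} {A B} → Γ ⊢ty B → Γ ⊢ty A → (Γ ▷ B) ⊢ty wkTy A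
  ⊢ty-wk₁ ⊢B = Weakening.⊢ty-wk ⊢B []

  subTy-wkTy³ : ∀ {n m} {σ : Sub (suc (suc (suc n))) m} {τ : Sub n m}
              → (∀ x → σ (suc (suc (suc x))) ≡ τ x)
              → ∀ A → subTy σ (wkTy (wkTy (wkTy A))) ≡ subTy τ A
  subTy-wkTy³ {σ = σ} h A = begin
    subTy σ (wkTy (wkTy (wkTy A)))              ≡⟨ cong (subTy σ ∘ wkTy) (renTy-renTy (λ _ → refl) A) ⟩
    subTy σ (wkTy (renTy (λ x → suc (suc x)) A)) ≡⟨ cong (subTy σ) (renTy-renTy (λ _ → refl) A) ⟩
    subTy σ (renTy (λ x → suc (suc (suc x))) A) ≡⟨ subTy-renTy h A ⟩
    subTy _ A                                   ∎
    where open ≡-Reasoning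

  subTy-σJ-wkTy³ : ∀ {n} (A A' : Ty n) → subTy (σJ A') (wkTy (wkTy (wkTy A))) ≡ wkTy A
  subTy-σJ-wkTy³ A A' = trans (subTy-wkTy³ (λ _ → refl) A) (subTy-var (λ _ → refl) A)

  subTy-sub3-wkTy³ : ∀ {n} (A : Ty n) a b p → subTy (sub3 a b p) (wkTy (wkTy (wkTy A))) ≡ A
  subTy-sub3-wkTy³ A a b p = trans (subTy-wkTy³ {τ = var} (λ _ → refl) A) (subTy-id (λ _ → refl) A)

  JCtx : ∀ {n} → Ctx n → Ty n → Ctx (suc (suc (suc n)))
  JCtx Γ A = ((Γ ▷ A) ▷ wkTy A) ▷ IdT (wkTy (wkTy A)) (var (suc zero)) (var zero)

  ⊢JCtx : ∀ {n} {Γ : Ctx n} {A} → ⊢ Γ → Γ ⊢ty A → ⊢ JCtx Γ A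
  ⊢JCtx {Γ = Γ} {A} ⊢Γ ⊢A = ⊢▷ ⊢Γ₂ (Id-ty (⊢ty-wk₁ ⊢A₁ ⊢A₁) (var-tm ⊢Γ₂) (var-tm ⊢Γ₂))
    where
      ⊢A₁ : (Γ ▷ A) ⊢ty wkTy A
      ⊢A₁ = ⊢ty-wk₁ ⊢A ⊢A
      ⊢Γ₂ : ⊢ ((Γ ▷ A) ▷ wkTy A)
      ⊢Γ₂ = ⊢▷ (⊢▷ ⊢Γ ⊢A) ⊢A₁

  -- The motive C(x, y, p) = Id_{Id(x,y)}(p, r(x)) of the J-proof of UIP.
  uipMotive : ∀ {n} → Ty n → Ty (suc (suc (suc n)))
  uipMotive {n} A = IdT (IdT (wkTy (wkTy (wkTy A))) x y) (var zero) (rfl (wkTy (wkTy (wkTy A))) x)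
    where
      x y : Tm (suc (suc (suc n)))
      x = var (suc (suc zero))
      y = var (suc zero)

  ⊢uipMotive : ∀ {n} {Γ : Ctx n} {A} → ⊢ Γ → Γ ⊢ty A → JCtx Γ A ⊢ty uipMotive A
  ⊢uipMotive {Γ = Γ} {A} ⊢Γ ⊢A =
    Id-ty (Id-ty ⊢A₃ ⊢x (var-tm ⊢Γ₃)) ⊢p
          -- r(x) : Id(x, y) because reflection turns p into x ≐ y
          (conv-tm (rfl-tm ⊢x) (Id-cong (ty-refl ⊢A₃) (tm-refl ⊢x) (reflection ⊢p)))
    where
      ⊢Γ₃ : ⊢ JCtx Γ A
      ⊢Γ₃ = ⊢JCtx ⊢Γ ⊢A
      ⊢A₃ : JCtx Γ A ⊢ty wkTy (wkTy (wkTy A))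
      ⊢A₃ with ⊢Γ₃
      ... | ⊢▷ (⊢▷ _ ⊢A₁) ⊢Id = ⊢ty-wk₁ ⊢Id (⊢ty-wk₁ ⊢A₁ ⊢A₁)
      ⊢x : JCtx Γ A ⊢ var (suc (suc zero)) ∶ wkTy (wkTy (wkTy A))
      ⊢x = var-tm ⊢Γ₃
      ⊢p : JCtx Γ A ⊢ var zero ∶ IdT (wkTy (wkTy (wkTy A))) (var (suc (suc zero))) (var (suc zero))
      ⊢p = var-tm ⊢Γ₃

  uip : ∀ {n} {Γ : Ctx n} {A a b γ} → ⊢ Γ → Γ ⊢ty A → Γ ⊢ γ ∶ IdT A a b
      → Γ ⊢ γ ≐ rfl A a ∶ IdT A a b
  uip {n} {Γ} {A} {a} {b} {γ} ⊢Γ ⊢A ⊢γ =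
    subst (λ A' → Γ ⊢ γ ≐ rfl A' a ∶ IdT A' a b) (subTy-sub3-wkTy³ A a b γ)
          (reflection (J-tm (⊢uipMotive ⊢Γ ⊢A) ⊢base ⊢γ))
    where
      v₀ : Tm (suc n)
      v₀ = var zero
      ⊢base : (Γ ▷ A) ⊢ rfl (IdT (wkTy A) v₀ v₀) (rfl (wkTy A) v₀) ∶ subTy (σJ A) (uipMotive A)
      ⊢base = subst (λ A' → (Γ ▷ A) ⊢ rfl (IdT (wkTy A) v₀ v₀) (rfl (wkTy A) v₀)
                                      ∶ IdT (IdT A' v₀ v₀) (rfl (wkTy A) v₀) (rfl A' v₀))
                    (sym (subTy-σJ-wkTy³ A A))
                    (rfl-tm (rfl-tm (var-tm (⊢▷ ⊢Γ ⊢A))))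

  PreTy-ty : ∀ {n} (p : Pre n) → ε ⊢ty PreTy p
  PreTy-ty {zero}  _                       = Base-ty ⊢ε
  PreTy-ty {suc n} (p , b₀ , b₁ , d₀ , d₁) = Id-ty (PreTy-ty p) d₀ d₁

  T₀-idc-src≈id : ∀ {n} (x : T₀Cell (suc n)) → CellEq (T₀idc (T₀src x)) x
  T₀-idc-src≈id ((p , b₀ , b₁ , d₀ , d₁) , γ , ⊢γ) =
    (PreEq-refl p , tm-refl d₀ , b₀≐b₁) ,
    tm-conv (tm-sym (uip ⊢ε (PreTy-ty p) ⊢γ))
            (Id-cong (ty-refl (PreTy-ty p)) (tm-refl d₀) (tm-sym b₀≐b₁))
    where
      b₀≐b₁ : ε ⊢ b₀ ≐ b₁ ∶ PreTy p
      b₀≐b₁ = reflection ⊢γ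

lemma4p1 : (G : RGlob) → IsConstant (T₀ G)
lemma4p1 G = Degenerate.degenerate⇒constant (T₀ G) (Metatheory.T₀-idc-src≈id G)
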